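{- Let $K=\mathbb{Q}(\sqrt{D})$ where $D\in\mathbb{Z}_{\ge2}$ is squarefree. (i) There exists $\alpha\in\mathcal{O}_K^+$ such that $p_K(\alpha)=4$. (ii) If $\lceil\xi_D\rceil-\xi_D>\frac12$, then there exists $\alpha\in\mathcal{O}_K^+$ such that $p_K(\alpha)=6$.
   Context: $\mathcal{O}_K$ is the ring of integers of $K$ and $\mathcal{O}_K^+$ is the set of totally positive elements of $\mathcal{O}_K$ (elements $\gamma$ with $\gamma>0$ and $\gamma'>0$, where $'$ denotes Galois conjugation). A partition of $\alpha\in\mathcal{O}_K^+$ is an expression $\alpha=\alpha_1+\dots+\alpha_k$ with $k\ge1$ and all $\alpha_i\in\mathcal{O}_K^+$, the order of the summands being irrelevant; $p_K(\alpha)$ is the number of partitions of $\alpha$. Define $\xi_D=\sqrt{D}$ if $D\equiv2,3\pmod4$ and $\xi_D=\frac{\sqrt{D}-1}{2}$ if $D\equiv1\pmod4$. -}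

module Defs where

open import Data.Nat as ℕ using (ℕ; _%_; _≡ᵇ_)
import Data.Nat.Divisibility as ℕD
open import Data.Integer using (ℤ; +_; _+_; _-_; _*_; -_; _<_; 0ℤ)
open import Data.Integer.Divisibility using (_∣_)
open import Data.Bool using (if_then_else_)
open import Data.Product using (Σ; ∃; _×_; _,_; proj₁; proj₂)
open import Data.Sum using (_⊎_)
open import Data.List using (List; []; foldr)
open import Data.List.Relation.Unary.All using (All)
open import Data.List.Relation.Binary.Permutation.Propositional using (_↭_)
open import Data.Vec using (Vec; lookup)
open import Data.Fin using (Fin)
open import Relation.Binary.PropositionalEquality using (_≡_; _≢_)

SquareFree : ℕ → Set
SquareFree D = ∀ (m : ℕ) → (m ℕ.* m) ℕD.∣ D → m ≡ 1

-- An element of K = ℚ(√D) of the form (x + y√D)/2 is represented by the pair (x , y).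
Elt : Set
Elt = ℤ × ℤ

_⊕_ : Elt → Elt → Elt
(a , b) ⊕ (c , d) = (a + c , b + d)

zeroE : Elt
zeroE = (0ℤ , 0ℤ)

sumE : List Elt → Elt
sumE = foldr _⊕_ zeroE

InOK : ℕ → Elt → Set
InOK D (x , y) =
  (D % 4 ≡ 1 × (+ 2) ∣ (x - y)) ⊎ (D % 4 ≢ 1 × (+ 2) ∣ x × (+ 2) ∣ y)

-- PosSqrt D x y  means  x + y√D > 0  (for D not a perfect square):
-- either x > 0 and |y|√D < x, or y > 0 and |x| < y√D.
PosSqrt : ℕ → ℤ → ℤ → Set
PosSqrt D x y =
  (0ℤ < x × (+ D) * (y * y) < x * x) ⊎ (0ℤ < y × x * x < (+ D) * (y * y))

TotPos : ℕ → Elt → Set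
TotPos D (x , y) = PosSqrt D x y × PosSqrt D x (- y)

InOKPlus : ℕ → Elt → Set
InOKPlus D α = InOK D α × TotPos D α

IsPartition : ℕ → Elt → List Elt → Set
IsPartition D α l = l ≢ [] × All (InOKPlus D) l × sumE l ≡ α

PartitionCount : ℕ → Elt → ℕ → Set
PartitionCount D α n =
  Σ (Vec (List Elt) n) λ ps →
    (∀ i → IsPartition D α (lookup ps i)) ×
    (∀ i j → lookup ps i ↭ lookup ps j → i ≡ j) ×
    (∀ l → IsPartition D α l → ∃ λ (i : Fin n) → l ↭ lookup ps i)

-- ξ_D in the (x + y√D)/2 representation:
--   D ≡ 1 (mod 4): ξ_D = (√D − 1)/2  ↦ (−1 , 1);   otherwise ξ_D = √D ↦ (0 , 2).
xi : ℕ → Elt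
xi D = if (D % 4) ≡ᵇ 1 then (- (+ 1) , + 1) else (0ℤ , + 2)

-- ⌈ξ_D⌉ − ξ_D > 1/2.  Since ξ_D is irrational this says: ∃ n ∈ ℤ, n < ξ_D < n + 1/2,
-- i.e. with ξ_D = (u + v√D)/2:  (u − 2n) + v√D > 0  and  (2n + 1 − u) − v√D > 0.
CeilGap : ℕ → Set
CeilGap D =
  ∃ λ (n : ℤ) →
    PosSqrt D (proj₁ (xi D) - (+ 2) * n) (proj₂ (xi D)) ×
    PosSqrt D ((+ 2) * n + (+ 1) - proj₁ (xi D)) (- proj₂ (xi D))

module Submission where

-- Write 𝒪_K = ℤ[ω] with ω = ((c + 2) + h√D)/2, where h = 1 and c is odd if D ≡ 1 (mod 4),
-- h = 2 and c is even otherwise, and c < h√D < c + 2; thus 0 < ω′ < 1 < ω.  If u + vω is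
-- totally positive with v ≥ 0 then u + v ≥ 1, so it is (k + 1) + m(ω − 1) with k, m ≥ 0;
-- a totally positive summand with v < 0 is heavy for a positive linear form (u + v if
-- ω′ > 1/2, 2u + v otherwise), too heavy to occur in a partition of 2 + ω or 1 + 2ω.
-- The partitions of these two elements are therefore lists of pairs (k , m) with prescribed
-- sums, enumerated by a finite search: 2 + ω has 4 of them, and when ω′ > 1/2 (which is
-- what ⌈ξ_D⌉ − ξ_D > 1/2 allows us to arrange) 1 + 2ω has 6, one of them using 2ω − 1.

open import Algebra.Bundles using (AbelianGroup)
open import Data.Empty using (⊥-elim)
open import Data.Fin using (Fin; zero; suc)
import Data.Fin.Properties as FinP
open import Data.Integer as ℤ using (ℤ; +_; -[1+_]; _+_; _-_; _*_; -_; 0ℤ; +≤+; +<+; ∣_∣)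
open import Data.Integer.Divisibility using (_∣_)
open import Data.Integer.Divisibility.Signed using (divides; ∣⇒∣ᵤ; ∣ᵤ⇒∣)
import Data.Integer.Properties as ℤP
open import Data.Integer.Tactic.RingSolver using (solve-∀)
open import Data.List using (List; []; _∷_; [_]; _++_; map; upTo; cartesianProduct; cartesianProductWith)
import Data.List.Properties as ListP
open import Data.List.Membership.Propositional using (_∈_)
open import Data.List.Membership.Propositional.Properties
  using (∈-map⁻; ∈-∃++; ∈-upTo⁺; ∈-cartesianProduct⁺; ∈-cartesianProductWith⁺)
open import Data.List.Relation.Binary.Permutation.Propositional
  using (_↭_; ↭-refl; ↭-sym; ↭-trans; ↭-prep; ↭⇒↭ₛ)
import Data.List.Relation.Binary.Permutation.Propositional.Properties as ↭P
import Data.List.Relation.Binary.Permutation.Homogeneous as Homogeneous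
import Data.List.Relation.Binary.Permutation.Setoid as SetoidPermutation
import Data.List.Relation.Binary.Pointwise as Pointwise
open import Data.List.Relation.Unary.All as All using (All; []; _∷_)
import Data.List.Relation.Unary.All.Properties as AllP
open import Data.List.Relation.Unary.Any using (here; there)
open import Data.List.Relation.Unary.Sorted.TotalOrder.Properties using (↗↭↗⇒≋)
open import Data.List.Sort.Base using (SortingAlgorithm)
open import Data.Nat as ℕ using (ℕ; zero; suc; z≤n; s≤s; _%_; _≤_)
import Data.Nat.Divisibility as ℕD
open import Data.Nat.ListAction using (sum)
import Data.Nat.Properties as ℕP
open import Data.Nat.Tactic.RingSolver using () renaming (solve-∀ to ℕ-solve)
open import Data.Product using (Σ; ∃; _×_; _,_; proj₁; proj₂; map₂; uncurry)
import Data.Product.Properties as ×P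
open import Data.Product.Relation.Binary.Lex.NonStrict using (×-decTotalOrder)
open import Data.Product.Relation.Binary.Pointwise.NonDependent using (≡×≡⇒≡)
open import Data.Sum using (_⊎_; inj₁; inj₂)
open import Data.Vec using (tabulate; lookup)
open import Data.Vec.Properties using (lookup∘tabulate)
open import Function using (_∘_)
open import Relation.Binary.Bundles using (DecTotalOrder)
open import Relation.Binary.PropositionalEquality hiding ([_])
open import Relation.Nullary using (Dec; yes; no; ¬_)
open import Relation.Nullary.Decidable using (_→-dec_; toWitness)

open import Defs

open import Algebra.Properties.Group (AbelianGroup.group ℤP.+-0-abelianGroup)
  using () renaming (∙-cancelʳ to +-cancelʳ)

square-mono-≤ : ∀ {m n} → m ℕ.≤ n → m ℕ.* m ℕ.≤ n ℕ.* n
square-mono-≤ m≤n = ℕP.*-mono-≤ m≤n m≤n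

square-cancel-< : ∀ {m n} → m ℕ.* m ℕ.< n ℕ.* n → m ℕ.< n
square-cancel-< {m} {n} m²<n² with m ℕ.<? n
... | yes m<n = m<n
... | no m≮n = ⊥-elim (ℕP.<⇒≱ m²<n² (square-mono-≤ (ℕP.≮⇒≥ m≮n)))

*-square : ∀ m n → (m ℕ.* n) ℕ.* (m ℕ.* n) ≡ (m ℕ.* m) ℕ.* (n ℕ.* n)
*-square = ℕ-solve

dominated-by-root : ∀ b w {e x} → b ℕ.* b ℕ.≤ e → e ℕ.* (w ℕ.* w) ℕ.< x ℕ.* x → b ℕ.* w ℕ.< x
dominated-by-root b w {e} {x} b²≤e ew²<x² = square-cancel-< (begin-strict
  (b ℕ.* w) ℕ.* (b ℕ.* w) ≡⟨ *-square b w ⟩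
  (b ℕ.* b) ℕ.* (w ℕ.* w) ≤⟨ ℕP.*-monoˡ-≤ (w ℕ.* w) b²≤e ⟩
  e ℕ.* (w ℕ.* w)         <⟨ ew²<x² ⟩
  x ℕ.* x                 ∎)
  where open ℕP.≤-Reasoning

square-pos : ∀ n → + n * + n ≡ + (n ℕ.* n)
square-pos n = sym (ℤP.pos-* n n)

square-abs : ∀ z → z * z ≡ + (∣ z ∣ ℕ.* ∣ z ∣)
square-abs (+ n) = sym (ℤP.pos-* n n)
square-abs -[1+ n ] = refl

neg-square : ∀ y → (- y) * (- y) ≡ y * y
neg-square = solve-∀

sub-add : ∀ x y → x - y + y ≡ x
sub-add = solve-∀

+≡+⇒1≤ : ∀ z k n → z + + k ≡ + n → k ℕ.< n → + 1 ℤ.≤ z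
+≡+⇒1≤ (+ zero) k n k≡n k<n = ⊥-elim (ℕP.<-irrefl (ℤP.+-injective k≡n) k<n)
+≡+⇒1≤ (+ suc _) _ _ _ _ = +≤+ (s≤s z≤n)
+≡+⇒1≤ -[1+ m ] k n z+k≡n k<n = ⊥-elim (ℕP.<⇒≱ k<n
  (ℤP.drop‿+≤+ (subst (ℤ._≤ + k) z+k≡n (ℤP.m⊖n≤m k (suc m)))))

-≡+⇒≤ : ∀ z k n b → z - + k ≡ + n → k ℕ.< n → b ℕ.≤ k → + suc (2 ℕ.* b) ℤ.≤ z
-≡+⇒≤ z k n b z-k≡n k<n b≤k = subst (+ suc (2 ℕ.* b) ℤ.≤_) (sym z≡n+k)
  (+≤+ (ℕP.+-mono-≤ (ℕP.≤-trans (s≤s b≤k) k<n) (ℕP.≤-trans (ℕP.≤-reflexive (ℕP.+-identityʳ b)) b≤k)))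
  where
  z≡n+k : z ≡ + (n ℕ.+ k)
  z≡n+k = begin
    z             ≡⟨ sym (sub-add z (+ k)) ⟩
    z - + k + + k ≡⟨ cong (_+ + k) z-k≡n ⟩
    + n + + k     ≡⟨ sym (ℤP.pos-+ n k) ⟩
    + (n ℕ.+ k)   ∎
    where open ≡-Reasoning

≤-half : ∀ k z → + suc (2 ℕ.* k) ℤ.≤ + 2 * z → + suc k ℤ.≤ z
≤-half k (+ n) 1+2k≤2n = +≤+ (ℕP.*-cancelˡ-< 2 k n
  (ℤP.drop‿+≤+ (subst (+ suc (2 ℕ.* k) ℤ.≤_) (sym (ℤP.pos-* 2 n)) 1+2k≤2n)))
≤-half k -[1+ n ] ()

i<i+j : ∀ i j → + 1 ℤ.≤ j → i ℤ.< i + j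
i<i+j i j 1≤j = ℤP.suc[i]≤j⇒i<j (subst (ℤ._≤ i + j) (ℤP.+-comm i (+ 1)) (ℤP.+-monoʳ-≤ i 1≤j))

pos+pos≢1 : ∀ {i j} → 0ℤ ℤ.< i → 0ℤ ℤ.< j → i + j ≢ + 1
pos+pos≢1 {+ suc m} {+ suc n} _ _ i+j≡1 = ℕP.m+1+n≢0 m (ℕP.suc-injective (ℤP.+-injective i+j≡1))
pos+pos≢1 {+ zero} (+<+ ()) _ _
pos+pos≢1 {+ suc _} {+ zero} _ (+<+ ()) _

0≮- : ∀ n → ¬ (0ℤ ℤ.< - + n)
0≮- zero (+<+ ())
0≮- (suc n) ()

totPos⇒dominant : ∀ {D x y} → TotPos D (x , y) → 0ℤ ℤ.< x × + D * (y * y) ℤ.< x * x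
totPos⇒dominant (inj₁ x-dominant , _) = x-dominant
totPos⇒dominant {D} {x} {y} (inj₂ (_ , x²<Dy²) , inj₁ (_ , Dy²<x²)) =
  ⊥-elim (ℤP.<-asym x²<Dy² (subst (λ t → + D * t ℤ.< x * x) (neg-square y) Dy²<x²))
totPos⇒dominant {D} {x} {y} (inj₂ (0<y , _) , inj₂ (0<-y , _)) =
  ⊥-elim (ℤP.<-asym 0<y (subst (ℤ._< 0ℤ) (ℤP.neg-involutive y) (ℤP.neg-mono-< 0<-y)))

dominant⇒totPos : ∀ {D x y} → 0ℤ ℤ.< x → + D * (y * y) ℤ.< x * x → TotPos D (x , y)
dominant⇒totPos {D} {x} {y} 0<x Dy²<x² =
  inj₁ (0<x , Dy²<x²) , inj₁ (0<x , subst (λ t → + D * t ℤ.< x * x) (sym (neg-square y)) Dy²<x²)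

-- The element u + vω, with ω = ((2 + c) + h√D)/2.
fromCoords : ℕ → ℕ → ℤ × ℤ → Elt
fromCoords c h (u , v) = (+ 2 * u + + (2 ℕ.+ c) * v , + h * v)

fromCoords-⊕ : ∀ c h p q → fromCoords c h (p ⊕ q) ≡ fromCoords c h p ⊕ fromCoords c h q
fromCoords-⊕ c h (u , v) (u′ , v′) =
  cong₂ _,_ (distrib u v u′ v′ (+ (2 ℕ.+ c))) (ℤP.*-distribˡ-+ (+ h) v v′)
  where
  distrib : ∀ u v u′ v′ C → + 2 * (u + u′) + C * (v + v′) ≡ (+ 2 * u + C * v) + (+ 2 * u′ + C * v′)
  distrib = solve-∀

fromCoords-sumE : ∀ c h l → fromCoords c h (sumE l) ≡ sumE (map (fromCoords c h) l)
fromCoords-sumE c h [] = cong₂ _,_ (annihilate (+ (2 ℕ.+ c))) (ℤP.*-zeroʳ (+ h))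
  where
  annihilate : ∀ C → + 2 * 0ℤ + C * 0ℤ ≡ 0ℤ
  annihilate = solve-∀
fromCoords-sumE c h (p ∷ l) =
  trans (fromCoords-⊕ c h p (sumE l)) (cong (fromCoords c h p ⊕_) (fromCoords-sumE c h l))

fromCoords-injective : ∀ c h .{{_ : ℕ.NonZero h}} {p q} → fromCoords c h p ≡ fromCoords c h q → p ≡ q
fromCoords-injective c h {u , v} {u′ , v′} eq = cong₂ _,_ u≡u′ v≡v′
  where
  v≡v′ : v ≡ v′
  v≡v′ = ℤP.*-cancelˡ-≡ (+ h) v v′ (cong proj₂ eq)
  u≡u′ : u ≡ u′
  u≡u′ = ℤP.*-cancelˡ-≡ (+ 2) u u′ (+-cancelʳ _ _ _
    (trans (cong proj₁ eq) (cong (λ t → + 2 * u′ + + (2 ℕ.+ c) * t) (sym v≡v′))))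

pos-square-scaled : ∀ D h m → + D * ((+ h * m) * (+ h * m)) ≡ + ((D ℕ.* (h ℕ.* h)) ℕ.* (∣ m ∣ ℕ.* ∣ m ∣))
pos-square-scaled D h m = begin
  + D * ((+ h * m) * (+ h * m))                      ≡⟨ cong (+ D *_) (square-abs (+ h * m)) ⟩
  + D * + (∣ + h * m ∣ ℕ.* ∣ + h * m ∣)              ≡⟨ cong (λ t → + D * + (t ℕ.* t)) (ℤP.abs-* (+ h) m) ⟩
  + D * + ((h ℕ.* ∣ m ∣) ℕ.* (h ℕ.* ∣ m ∣))          ≡⟨ sym (ℤP.pos-* D _) ⟩
  + (D ℕ.* ((h ℕ.* ∣ m ∣) ℕ.* (h ℕ.* ∣ m ∣)))        ≡⟨ cong (λ t → + (D ℕ.* t)) (*-square h ∣ m ∣) ⟩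
  + (D ℕ.* ((h ℕ.* h) ℕ.* (∣ m ∣ ℕ.* ∣ m ∣)))        ≡⟨ cong +_ (sym (ℕP.*-assoc D _ _)) ⟩
  + ((D ℕ.* (h ℕ.* h)) ℕ.* (∣ m ∣ ℕ.* ∣ m ∣))        ∎
  where open ≡-Reasoning

-- b² ≤ Dh² says b ≤ h√D, and total positivity gives 2u + (2 + c)v > h√D|v| ≥ b|v|.
totPos⇒first-coord> : ∀ {D} c h b {u v} → b ℕ.* b ℕ.≤ D ℕ.* (h ℕ.* h) →
  TotPos D (fromCoords c h (u , v)) →
  Σ ℕ λ n → + 2 * u + + (2 ℕ.+ c) * v ≡ + n × b ℕ.* ∣ v ∣ ℕ.< n
totPos⇒first-coord> {D} c h b {u} {v} b²≤Dh² tp = bound (totPos⇒dominant {D} tp)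
  where
  bound : ∀ {x} → 0ℤ ℤ.< x × + D * ((+ h * v) * (+ h * v)) ℤ.< x * x →
          Σ ℕ λ n → x ≡ + n × b ℕ.* ∣ v ∣ ℕ.< n
  bound {+ n} (_ , Dy²<x²) = n , refl , dominated-by-root b ∣ v ∣ b²≤Dh²
    (ℤP.drop‿+<+ (subst₂ ℤ._<_ (pos-square-scaled D h v) (sym (ℤP.pos-* n n)) Dy²<x²))

first-coord<⇒totPos : ∀ {D} c h {u m n} → + 2 * u + + (2 ℕ.+ c) * + m ≡ + n →
  (D ℕ.* (h ℕ.* h)) ℕ.* (m ℕ.* m) ℕ.< n ℕ.* n → TotPos D (fromCoords c h (u , + m))
first-coord<⇒totPos {D} c h {u} {m} {zero} _ ()
first-coord<⇒totPos {D} c h {u} {m} {suc n} x≡n Dh²m²<n² = dominant⇒totPos {D}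
  (subst (0ℤ ℤ.<_) (sym x≡n) (+<+ (s≤s z≤n)))
  (subst₂ ℤ._<_ (sym (pos-square-scaled D h (+ m)))
    (trans (ℤP.pos-* (suc n) (suc n)) (cong₂ _*_ (sym x≡n) (sym x≡n))) (+<+ Dh²m²<n²))

-- As 2u + (2 + c)v > b|v|, the form z = 2u + (2 + c)v − bv is positive, and exceeds 2b|v| if v < 0.
totPos⇒lower-bounds : ∀ {D} c h b {u v} z → b ℕ.* b ℕ.≤ D ℕ.* (h ℕ.* h) →
  z + + b * v ≡ + 2 * u + + (2 ℕ.+ c) * v → TotPos D (fromCoords c h (u , v)) →
  (0ℤ ℤ.≤ v → + 1 ℤ.≤ z) × (v ℤ.< 0ℤ → + suc (2 ℕ.* b) ℤ.≤ z)
totPos⇒lower-bounds {D} c h b {u} {v} z b²≤Dh² z+bv≡x tp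
  with totPos⇒first-coord> {D} c h b {u} {v} b²≤Dh² tp
totPos⇒lower-bounds c h b {v = + m} z _ z+bv≡x _ | n , x≡n , bm<n =
  (λ _ → +≡+⇒1≤ z (b ℕ.* m) n z+bm≡n bm<n) , λ { (+<+ ()) }
  where
  z+bm≡n : z + + (b ℕ.* m) ≡ + n
  z+bm≡n = trans (cong (_+_ z) (ℤP.pos-* b m)) (trans z+bv≡x x≡n)
totPos⇒lower-bounds c h b {v = -[1+ w ]} z _ z+bv≡x _ | n , x≡n , b[1+w]<n =
  (λ ()) , λ _ → -≡+⇒≤ z (b ℕ.* suc w) n b z-b[1+w]≡n b[1+w]<n (ℕP.m≤m*n b (suc w))
  where
  z-b[1+w]≡n : z - + (b ℕ.* suc w) ≡ + n
  z-b[1+w]≡n = trans (cong (λ t → z - t) (ℤP.pos-* b (suc w)))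
    (trans (cong (_+_ z) (ℤP.neg-distribʳ-* (+ b) (+ suc w))) (trans z+bv≡x x≡n))

-- Weighing the summands of a partition

linForm : ℤ → ℤ → ℤ × ℤ → ℤ
linForm a b (u , v) = a * u + b * v

linForm-⊕ : ∀ a b p q → linForm a b (p ⊕ q) ≡ linForm a b p + linForm a b q
linForm-⊕ a b (u , v) (u′ , v′) = distrib a b u v u′ v′
  where
  distrib : ∀ a b u v u′ v′ → a * (u + u′) + b * (v + v′) ≡ (a * u + b * v) + (a * u′ + b * v′)
  distrib = solve-∀

linForm-zero : ∀ a b → linForm a b zeroE ≡ 0ℤ
linForm-zero a b = annihilate a b
  where
  annihilate : ∀ a b → a * 0ℤ + b * 0ℤ ≡ 0ℤ
  annihilate = solve-∀

module Summands (a b : ℤ) (M : ℕ) where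

  μ : ℤ × ℤ → ℤ
  μ = linForm a b

  Admissible : ℤ × ℤ → Set
  Admissible p = + 1 ℤ.≤ μ p × (proj₂ p ℤ.< 0ℤ → + M ℤ.≤ μ p)

  μ-sum-nonneg : ∀ {l} → All Admissible l → 0ℤ ℤ.≤ μ (sumE l)
  μ-sum-nonneg [] = ℤP.≤-reflexive (sym (linForm-zero a b))
  μ-sum-nonneg {p ∷ l} ((1≤μp , _) ∷ adm) = subst (0ℤ ℤ.≤_) (sym (linForm-⊕ a b p (sumE l)))
    (ℤP.+-mono-≤ (ℤP.≤-trans (+≤+ z≤n) 1≤μp) (μ-sum-nonneg adm))

  μ-sum-pos : ∀ {q l} → All Admissible (q ∷ l) → + 1 ℤ.≤ μ (sumE (q ∷ l))
  μ-sum-pos {q} {l} ((1≤μq , _) ∷ adm) = subst (+ 1 ℤ.≤_) (sym (linForm-⊕ a b q (sumE l)))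
    (ℤP.+-mono-≤ {+ 1} {μ q} {0ℤ} 1≤μq (μ-sum-nonneg adm))

  summands-light : ∀ {l} R → All Admissible l → + 1 ℤ.≤ R → All (λ p → μ p ℤ.< μ (sumE l) + R) l
  summands-light R [] _ = []
  summands-light {p ∷ l} R (adm-p ∷ adm) 1≤R =
    subst (μ p ℤ.<_) (sym total≡) (i<i+j (μ p) _ rest≥1)
    ∷ All.map (subst (μ _ ℤ.<_) (trans reorder (sym total≡)))
        (summands-light (μ p + R) adm
          (ℤP.+-mono-≤ {+ 1} {μ p} {0ℤ} (proj₁ adm-p) (ℤP.≤-trans (+≤+ z≤n) 1≤R)))
    where
    total≡ : μ (sumE (p ∷ l)) + R ≡ μ p + (μ (sumE l) + R)
    total≡ = trans (cong (_+ R) (linForm-⊕ a b p (sumE l))) (ℤP.+-assoc (μ p) _ R)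
    reorder : μ (sumE l) + (μ p + R) ≡ μ p + (μ (sumE l) + R)
    reorder = swap-assoc (μ (sumE l)) (μ p) R
      where
      swap-assoc : ∀ x y z → x + (y + z) ≡ y + (x + z)
      swap-assoc = solve-∀
    rest≥1 : + 1 ℤ.≤ μ (sumE l) + R
    rest≥1 = ℤP.+-mono-≤ {0ℤ} (μ-sum-nonneg adm) 1≤R

  admissible : ∀ {p} → + 1 ℤ.≤ + M → (0ℤ ℤ.≤ proj₂ p → + 1 ℤ.≤ μ p) → (proj₂ p ℤ.< 0ℤ → + M ℤ.≤ μ p) →
               Admissible p
  admissible {p} 1≤M light heavy with 0ℤ ℤ.≤? proj₂ p
  ... | yes 0≤v = light 0≤v , λ v<0 → ⊥-elim (ℤP.<⇒≱ v<0 0≤v)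
  ... | no 0≰v = ℤP.≤-trans 1≤M (heavy (ℤP.≰⇒> 0≰v)) , heavy

  light⇒nonneg : ∀ {p} → Admissible p → μ p ℤ.< + M → 0ℤ ℤ.≤ proj₂ p
  light⇒nonneg {p} (_ , heavy) μp<M with 0ℤ ℤ.≤? proj₂ p
  ... | yes 0≤v = 0≤v
  ... | no 0≰v = ⊥-elim (ℤP.<⇒≱ μp<M (heavy (ℤP.≰⇒> 0≰v)))

  -- A summand with negative ω-coordinate would weigh M alone, leaving no room for others.
  summands-nonneg : ∀ {l} → All Admissible l → μ (sumE l) ≡ + M → 0ℤ ℤ.≤ proj₂ (sumE l) →
                    All (λ p → 0ℤ ℤ.≤ proj₂ p) l
  summands-nonneg [] _ _ = []
  summands-nonneg {p ∷ []} (_ ∷ []) _ 0≤v = subst (0ℤ ℤ.≤_) (ℤP.+-identityʳ (proj₂ p)) 0≤v ∷ []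
  summands-nonneg {p ∷ q ∷ l} (adm-p ∷ adm) μ≡M _ =
    light⇒nonneg adm-p (subst (μ p ℤ.<_) μ≡M′ (i<i+j (μ p) _ (μ-sum-pos adm)))
    ∷ All.zipWith (λ (adm-r , μr<) → light⇒nonneg adm-r
                     (subst (μ _ ℤ.<_) (trans (ℤP.+-comm _ (μ p)) μ≡M′) μr<))
        (adm , summands-light (μ p) adm (proj₁ adm-p))
    where
    μ≡M′ : μ p + μ (sumE (q ∷ l)) ≡ + M
    μ≡M′ = trans (sym (linForm-⊕ a b p (sumE (q ∷ l)))) μ≡M

-- (k , m) stands for the coordinates of (k + 1) + m(ω − 1).
canonical : ℕ × ℕ → ℤ × ℤ
canonical (k , m) = (+ suc k - + m , + m)

canonical-injective : ∀ {x y} → canonical x ≡ canonical y → x ≡ y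
canonical-injective {k , m} {k′ , m′} eq with ℤP.+-injective (cong proj₂ eq)
... | refl = cong (_, m) (ℕP.suc-injective (ℤP.+-injective (begin
  + suc k             ≡⟨ sym (sub-add (+ suc k) (+ m)) ⟩
  + suc k - + m + + m ≡⟨ cong (_+ + m) (cong proj₁ eq) ⟩
  + suc k′ - + m + + m ≡⟨ sub-add (+ suc k′) (+ m) ⟩
  + suc k′            ∎)))
  where open ≡-Reasoning

nonneg⇒canonical : ∀ {p} → 0ℤ ℤ.≤ proj₂ p → + 1 ℤ.≤ linForm (+ 1) (+ 1) p → ∃ λ x → canonical x ≡ p
nonneg⇒canonical {u , + m} _ 1≤u+v = go _ refl 1≤u+v
  where
  u≡ : ∀ u v → + 1 * u + + 1 * v - v ≡ u
  u≡ = solve-∀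
  go : ∀ s → + 1 * u + + 1 * + m ≡ s → + 1 ℤ.≤ s → ∃ λ x → canonical x ≡ (u , + m)
  go (+ suc k) s≡ _ = (k , m) , cong (_, + m) (trans (cong (_- + m) (sym s≡)) (u≡ u (+ m)))
  go (+ zero) _ (+≤+ ())

linForm-canonical : ∀ k m → linForm (+ 1) (+ 1) (canonical (k , m)) ≡ + suc k
linForm-canonical k m = unit-form (+ suc k) (+ m)
  where
  unit-form : ∀ s m → + 1 * (s - m) + + 1 * m ≡ s
  unit-form = solve-∀

canonical-sum₁ : ∀ L → linForm (+ 1) (+ 1) (sumE (map canonical L)) ≡ + sum (map (suc ∘ proj₁) L)
canonical-sum₁ [] = refl
canonical-sum₁ ((k , m) ∷ L) = begin
  linForm (+ 1) (+ 1) (canonical (k , m) ⊕ sumE (map canonical L))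
    ≡⟨ linForm-⊕ (+ 1) (+ 1) (canonical (k , m)) _ ⟩
  linForm (+ 1) (+ 1) (canonical (k , m)) + linForm (+ 1) (+ 1) (sumE (map canonical L))
    ≡⟨ cong₂ _+_ (linForm-canonical k m) (canonical-sum₁ L) ⟩
  + suc k + + sum (map (suc ∘ proj₁) L)
    ≡⟨ sym (ℤP.pos-+ (suc k) _) ⟩
  + sum (map (suc ∘ proj₁) ((k , m) ∷ L)) ∎
  where open ≡-Reasoning

canonical-sum₂ : ∀ L → proj₂ (sumE (map canonical L)) ≡ + sum (map proj₂ L)
canonical-sum₂ [] = refl
canonical-sum₂ ((k , m) ∷ L) = trans (cong (_+_ (+ m)) (canonical-sum₂ L)) (sym (ℤP.pos-+ m _))

map⁻-injective : ∀ {A B : Set} {f : A → B} → (∀ {x y} → f x ≡ f y → x ≡ y) →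
                 ∀ {xs ys} → map f xs ↭ map f ys → xs ↭ ys
map⁻-injective inj {[]} {[]} _ = ↭-refl
map⁻-injective inj {[]} {_ ∷ _} p = ⊥-elim (↭P.¬x∷xs↭[] (↭-sym p))
map⁻-injective {f = f} inj {x ∷ xs} {ys} p with ∈-map⁻ f (↭P.∈-resp-↭ p (here refl))
... | y , y∈ys , fx≡fy with ∈-∃++ (subst (_∈ ys) (sym (inj fx≡fy)) y∈ys)
... | ys₁ , ys₂ , refl = ↭-trans (↭-prep x (map⁻-injective inj xs↭ys₁ys₂)) (↭-sym (↭P.shift x ys₁ ys₂))
  where
  fx∷xs↭ : [] ++ [ f x ] ++ map f xs ↭ map f ys₁ ++ [ f x ] ++ map f ys₂
  fx∷xs↭ = subst (map f (x ∷ xs) ↭_) (ListP.map-++ f ys₁ (x ∷ ys₂)) p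
  xs↭ys₁ys₂ : map f xs ↭ map f (ys₁ ++ ys₂)
  xs↭ys₁ys₂ = subst (map f xs ↭_) (sym (ListP.map-++ f ys₁ ys₂)) (↭P.drop-mid [] (map f ys₁) fx∷xs↭)

All-∃⇒map : ∀ {A B : Set} {f : A → B} {ys} → All (λ y → ∃ λ x → f x ≡ y) ys → ∃ λ xs → map f xs ≡ ys
All-∃⇒map [] = [] , refl
All-∃⇒map ((x , refl) ∷ all) with All-∃⇒map all
... | xs , refl = x ∷ xs , refl

ℕ²-order : DecTotalOrder _ _ _
ℕ²-order = ×-decTotalOrder ℕP.≤-decTotalOrder ℕP.≤-decTotalOrder

open DecTotalOrder ℕ²-order using (totalOrder; module Eq)
open import Data.List.Sort.InsertionSort ℕ²-order using (insertionSort)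
open SortingAlgorithm insertionSort using (sort; sort-↭; sort-↭ₛ; sort-↗)

↭⇒sort≡ : ∀ {xs ys} → xs ↭ ys → sort xs ≡ sort ys
↭⇒sort≡ {xs} {ys} xs↭ys = Pointwise.Pointwise-≡⇒≡ (Pointwise.map ≡×≡⇒≡
  (↗↭↗⇒≋ totalOrder (sort-↗ xs) (sort-↗ ys)
    (S.↭-trans (sort-↭ₛ xs)
      (S.↭-trans (Homogeneous.map Eq.reflexive (↭⇒↭ₛ xs↭ys)) (S.↭-sym (sort-↭ₛ ys))))))
  where module S = SetoidPermutation Eq.setoid

pairLists : ℕ → ℕ → List (List (ℕ × ℕ))
pairLists zero M = [ [] ]
pairLists (suc n) M =
  [] ∷ cartesianProductWith _∷_ (cartesianProduct (upTo (suc n)) (upTo (suc M))) (pairLists n M)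

∈-pairLists : ∀ {n M} L → sum (map (suc ∘ proj₁) L) ≤ n → sum (map proj₂ L) ≤ M → L ∈ pairLists n M
∈-pairLists {zero} [] _ _ = here refl
∈-pairLists {suc n} [] _ _ = here refl
∈-pairLists {suc n} {M} ((k , m) ∷ L) (s≤s k+S≤n) m+S′≤M = there
  (∈-cartesianProductWith⁺ _∷_
    (∈-cartesianProduct⁺ (∈-upTo⁺ (s≤s (ℕP.m+n≤o⇒m≤o k k+S≤n))) (∈-upTo⁺ (s≤s (ℕP.m+n≤o⇒m≤o m m+S′≤M))))
    (∈-pairLists L (ℕP.m+n≤o⇒n≤o k k+S≤n) (ℕP.m+n≤o⇒n≤o m m+S′≤M)))

Distinct : ∀ {n} → (Fin n → List (ℕ × ℕ)) → Set
Distinct t = ∀ i j → sort (t i) ≡ sort (t j) → i ≡ j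

-- Searching only pairLists, which holds every candidate, makes covering decidable.
Covers : ∀ {n} → ℕ × ℕ → (Fin n → List (ℕ × ℕ)) → Set
Covers (k , m) t = All (λ L → sum (map (suc ∘ proj₁) L) ≡ suc k → sum (map proj₂ L) ≡ m →
                              ∃ λ i → sort L ≡ sort (t i))
                       (pairLists (suc k) m)

_≟ₗ_ : (xs ys : List (ℕ × ℕ)) → Dec (xs ≡ ys)
_≟ₗ_ = ListP.≡-dec (×P.≡-dec ℕP._≟_ ℕP._≟_)

distinct? : ∀ {n} (t : Fin n → List (ℕ × ℕ)) → Dec (Distinct t)
distinct? t = FinP.all? λ i → FinP.all? λ j → (sort (t i) ≟ₗ sort (t j)) →-dec (i FinP.≟ j)

covers? : ∀ {n} x (t : Fin n → List (ℕ × ℕ)) → Dec (Covers x t)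
covers? (k , m) t = All.all? (λ L → (sum (map (suc ∘ proj₁) L) ℕP.≟ suc k) →-dec
                                     ((sum (map proj₂ L) ℕP.≟ m) →-dec
                                      FinP.any? λ i → sort L ≟ₗ sort (t i)))
                             (pairLists (suc k) m)

covers⇒↭ : ∀ {n k m} {t : Fin n → List (ℕ × ℕ)} → Covers (k , m) t → ∀ L →
           sum (map (suc ∘ proj₁) L) ≡ suc k → sum (map proj₂ L) ≡ m → ∃ λ i → L ↭ t i
covers⇒↭ {t = t} covers L sum₁≡ sum₂≡ with
  All.lookup covers (∈-pairLists L (ℕP.≤-reflexive sum₁≡) (ℕP.≤-reflexive sum₂≡)) sum₁≡ sum₂≡
... | i , sortL≡ = i , ↭-trans (↭-sym (sort-↭ L)) (subst (_↭ t i) (sym sortL≡) (sort-↭ (t i)))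

partitions-2+ω : Fin 4 → List (ℕ × ℕ)
partitions-2+ω zero                   = (2 , 1) ∷ []
partitions-2+ω (suc zero)             = (1 , 1) ∷ (0 , 0) ∷ []
partitions-2+ω (suc (suc zero))       = (0 , 1) ∷ (1 , 0) ∷ []
partitions-2+ω (suc (suc (suc zero))) = (0 , 1) ∷ (0 , 0) ∷ (0 , 0) ∷ []

partitions-1+2ω : Fin 6 → List (ℕ × ℕ)
partitions-1+2ω zero                               = (2 , 2) ∷ []
partitions-1+2ω (suc zero)                         = (0 , 2) ∷ (1 , 0) ∷ []
partitions-1+2ω (suc (suc zero))                   = (0 , 2) ∷ (0 , 0) ∷ (0 , 0) ∷ []
partitions-1+2ω (suc (suc (suc zero)))             = (1 , 2) ∷ (0 , 0) ∷ []
partitions-1+2ω (suc (suc (suc (suc zero))))       = (0 , 1) ∷ (1 , 1) ∷ []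
partitions-1+2ω (suc (suc (suc (suc (suc zero))))) = (0 , 1) ∷ (0 , 1) ∷ (0 , 0) ∷ []

-- Integral bases

-- The bounds c < h√D < c + 2 place ω′ = ((2 + c) − h√D)/2 in (0, 1).
record Basis (D : ℕ) : Set where
  field
    c h : ℕ
    .{{h-nonZero}} : ℕ.NonZero h
    lower : c ℕ.* c ℕ.< D ℕ.* (h ℕ.* h)
    upper : D ℕ.* (h ℕ.* h) ℕ.< (2 ℕ.+ c) ℕ.* (2 ℕ.+ c)
    c≥1 : 1 ≤ c
    ω′>½⇒c≥2 : D ℕ.* (h ℕ.* h) ℕ.< (1 ℕ.+ c) ℕ.* (1 ℕ.+ c) → 2 ≤ c
    fromCoords-inOK : ∀ p → InOK D (fromCoords c h p)
    fromCoords-onto : ∀ q → InOK D q → ∃ λ p → fromCoords c h p ≡ q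

ω′>½ : ∀ {D} → Basis D → Set
ω′>½ {D} B = D ℕ.* (h ℕ.* h) ℕ.< (1 ℕ.+ c) ℕ.* (1 ℕ.+ c)
  where open Basis B

module WithBasis {D} (B : Basis D) where

  open Basis B

  Dh² : ℕ
  Dh² = D ℕ.* (h ℕ.* h)

  e : ℤ × ℤ → Elt
  e = fromCoords c h

  e-injective : ∀ {p q} → e p ≡ e q → p ≡ q
  e-injective = fromCoords-injective c h

  e-sumE : ∀ l → e (sumE l) ≡ sumE (map e l)
  e-sumE = fromCoords-sumE c h

  elt : ℕ × ℕ → Elt
  elt = e ∘ canonical

  elt-injective : ∀ {x y} → elt x ≡ elt y → x ≡ y
  elt-injective = canonical-injective ∘ e-injective

  first-coord : ∀ k m → + 2 * (+ suc k - + m) + + (2 ℕ.+ c) * + m ≡ + (2 ℕ.* suc k ℕ.+ c ℕ.* m)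
  first-coord k m = begin
    + 2 * (+ suc k - + m) + (+ 2 + + c) * + m ≡⟨ rearrange (+ suc k) (+ m) (+ c) ⟩
    + 2 * + suc k + + c * + m                 ≡⟨ cong₂ _+_ (sym (ℤP.pos-* 2 (suc k))) (sym (ℤP.pos-* c m)) ⟩
    + (2 ℕ.* suc k) + + (c ℕ.* m)             ≡⟨ sym (ℤP.pos-+ (2 ℕ.* suc k) (c ℕ.* m)) ⟩
    + (2 ℕ.* suc k ℕ.+ c ℕ.* m)               ∎
    where
    open ≡-Reasoning
    rearrange : ∀ s m C → + 2 * (s - m) + (+ 2 + C) * m ≡ + 2 * s + C * m
    rearrange = solve-∀

  elt-totPos : ∀ k m → Dh² ℕ.* (m ℕ.* m) ℕ.< (2 ℕ.* suc k ℕ.+ c ℕ.* m) ℕ.* (2 ℕ.* suc k ℕ.+ c ℕ.* m) →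
               TotPos D (elt (k , m))
  elt-totPos k m =
    first-coord<⇒totPos {D} c h {+ suc k - + m} {m} {2 ℕ.* suc k ℕ.+ c ℕ.* m} (first-coord k m)

  elt₀-totPos : ∀ k → TotPos D (elt (k , 0))
  elt₀-totPos k = elt-totPos k 0 (subst (ℕ._< (2 ℕ.* suc k ℕ.+ c ℕ.* 0) ℕ.* (2 ℕ.* suc k ℕ.+ c ℕ.* 0))
    (sym (ℕP.*-zeroʳ Dh²)) (s≤s z≤n))

  elt₁-totPos : ∀ k → TotPos D (elt (k , 1))
  elt₁-totPos k = elt-totPos k 1 (subst (ℕ._< (2 ℕ.* suc k ℕ.+ c ℕ.* 1) ℕ.* (2 ℕ.* suc k ℕ.+ c ℕ.* 1))
    (sym (ℕP.*-identityʳ Dh²))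
    (ℕP.<-≤-trans upper (square-mono-≤
      (ℕP.+-mono-≤ (ℕP.*-monoʳ-≤ 2 (s≤s (z≤n {k}))) (ℕP.≤-reflexive (sym (ℕP.*-identityʳ c)))))))

  elt₂-totPos : ∀ k → Dh² ℕ.< (suc k ℕ.+ c) ℕ.* (suc k ℕ.+ c) → TotPos D (elt (k , 2))
  elt₂-totPos k Dh²<[1+k+c]² = elt-totPos k 2 (subst (Dh² ℕ.* 4 ℕ.<_) (quadruple (suc k) c)
    (ℕP.*-monoˡ-< 4 Dh²<[1+k+c]²))
    where
    quadruple : ∀ s c → (s ℕ.+ c) ℕ.* (s ℕ.+ c) ℕ.* 4 ≡ (2 ℕ.* s ℕ.+ c ℕ.* 2) ℕ.* (2 ℕ.* s ℕ.+ c ℕ.* 2)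
    quadruple = ℕ-solve

  unitForm≥ : ∀ p → TotPos D (e p) →
    (0ℤ ℤ.≤ proj₂ p → + 1 ℤ.≤ linForm (+ 1) (+ 1) p) × (proj₂ p ℤ.< 0ℤ → + suc c ℤ.≤ linForm (+ 1) (+ 1) p)
  unitForm≥ (u , v) tp with totPos⇒lower-bounds {D} c h c {u} {v} _ (ℕP.<⇒≤ lower) (split u v (+ c)) tp
    where
    split : ∀ u v C → + 2 * (+ 1 * u + + 1 * v) + C * v ≡ + 2 * u + (+ 2 + C) * v
    split = solve-∀
  ... | nonneg , neg = ≤-half 0 _ ∘ nonneg , ≤-half c _ ∘ neg

  binaryForm≥ : ∀ p → (1 ℕ.+ c) ℕ.* (1 ℕ.+ c) ≤ Dh² → TotPos D (e p) →
    (0ℤ ℤ.≤ proj₂ p → + 1 ℤ.≤ linForm (+ 2) (+ 1) p) × (proj₂ p ℤ.< 0ℤ → + 5 ℤ.≤ linForm (+ 2) (+ 1) p)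
  binaryForm≥ (u , v) [1+c]²≤Dh² tp
    with totPos⇒lower-bounds {D} c h (suc c) {u} {v} _ [1+c]²≤Dh² (split u v (+ c)) tp
    where
    split : ∀ u v C → (+ 2 * u + + 1 * v) + (+ 1 + C) * v ≡ + 2 * u + (+ 2 + C) * v
    split = solve-∀
  ... | nonneg , neg = nonneg , λ v<0 → ℤP.≤-trans (+≤+ (s≤s (ℕP.*-monoʳ-≤ 2 (s≤s c≥1)))) (neg v<0)

  NonnegSummands : ℤ × ℤ → Set
  NonnegSummands x = ∀ {l} → All (TotPos D ∘ e) l → sumE l ≡ x → All (λ p → 0ℤ ℤ.≤ proj₂ p) l

  nonnegSummands : ∀ a b M → 1 ≤ M →
    (∀ p → TotPos D (e p) →
       (0ℤ ℤ.≤ proj₂ p → + 1 ℤ.≤ linForm a b p) × (proj₂ p ℤ.< 0ℤ → + M ℤ.≤ linForm a b p)) →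
    ∀ {x} → linForm a b x ≡ + M → 0ℤ ℤ.≤ proj₂ x → NonnegSummands x
  nonnegSummands a b M 1≤M bounds μx≡M 0≤x₂ tps sum≡x = summands-nonneg
    (All.map (λ {p} tp → admissible (+≤+ 1≤M) (proj₁ (bounds p tp)) (proj₂ (bounds p tp))) tps)
    (trans (cong μ sum≡x) μx≡M) (subst (0ℤ ℤ.≤_) (sym (cong proj₂ sum≡x)) 0≤x₂)
    where open Summands a b M

  nonnegSummands-ω′>½ : ω′>½ B → ∀ {x} → linForm (+ 1) (+ 1) x ≡ + 3 → 0ℤ ℤ.≤ proj₂ x → NonnegSummands x
  nonnegSummands-ω′>½ ω′>½ = nonnegSummands (+ 1) (+ 1) 3 (s≤s z≤n)
    λ p tp → map₂ (ℤP.≤-trans (+≤+ (s≤s (ω′>½⇒c≥2 ω′>½))) ∘_) (unitForm≥ p tp)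

  nonnegSummands-ω′<½ : ¬ ω′>½ B → ∀ {x} → linForm (+ 2) (+ 1) x ≡ + 5 → 0ℤ ℤ.≤ proj₂ x → NonnegSummands x
  nonnegSummands-ω′<½ ω′≯½ = nonnegSummands (+ 2) (+ 1) 5 (s≤s z≤n) λ p → binaryForm≥ p (ℕP.≮⇒≥ ω′≯½)

  partition⇒canonical : ∀ {k m l} → NonnegSummands (canonical (k , m)) → IsPartition D (elt (k , m)) l →
    ∃ λ L → map elt L ≡ l × sum (map (suc ∘ proj₁) L) ≡ suc k × sum (map proj₂ L) ≡ m
  partition⇒canonical {k} {m} {l} nonneg (_ , inOK⁺ , sum≡)
    with All-∃⇒map (All.map (fromCoords-onto _ ∘ proj₁) inOK⁺)
  ... | l′ , refl
    with All-∃⇒map (All.zipWith (λ {p} (tp , 0≤v) → nonneg⇒canonical 0≤v (proj₁ (unitForm≥ p tp) 0≤v))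
                                                (tps , nonneg tps sum′≡))
    where
    tps : All (TotPos D ∘ e) l′
    tps = All.map proj₂ (AllP.map⁻ inOK⁺)
    sum′≡ : sumE l′ ≡ canonical (k , m)
    sum′≡ = e-injective (trans (e-sumE l′) sum≡)
  ... | L , refl = L , ListP.map-∘ L , ℤP.+-injective sum₁≡ , ℤP.+-injective sum₂≡
    where
    sum′≡ : sumE (map canonical L) ≡ canonical (k , m)
    sum′≡ = e-injective (trans (e-sumE (map canonical L)) sum≡)
    sum₁≡ : + sum (map (suc ∘ proj₁) L) ≡ + suc k
    sum₁≡ = trans (sym (canonical-sum₁ L)) (trans (cong (linForm (+ 1) (+ 1)) sum′≡) (linForm-canonical k m))
    sum₂≡ : + sum (map proj₂ L) ≡ + m
    sum₂≡ = trans (sym (canonical-sum₂ L)) (cong proj₂ sum′≡)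

  canonical-isPartition : ∀ x L → L ≢ [] → All (TotPos D ∘ elt) L → sumE (map canonical L) ≡ canonical x →
                      IsPartition D (elt x) (map elt L)
  canonical-isPartition x [] []≢[] _ _ = ⊥-elim ([]≢[] refl)
  canonical-isPartition x L@(_ ∷ _) _ tps sum≡ =
    (λ ()) ,
    AllP.map⁺ (All.map (λ {x} → fromCoords-inOK (canonical x) ,_) tps) ,
    trans (cong sumE (ListP.map-∘ {g = e} {f = canonical} L))
      (trans (sym (e-sumE (map canonical L))) (cong e sum≡))

  partitionCount : ∀ {n} x (t : Fin n → List (ℕ × ℕ)) → NonnegSummands (canonical x) →
    (∀ i → IsPartition D (elt x) (map elt (t i))) → Distinct t → Covers x t → PartitionCount D (elt x) n
  partitionCount x t nonneg parts distinct covers = tabulate (map elt ∘ t) , isPart , distinct′ , complete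
    where
    isPart : ∀ i → IsPartition D (elt x) (lookup (tabulate (map elt ∘ t)) i)
    isPart i = subst (IsPartition D (elt x)) (sym (lookup∘tabulate _ i)) (parts i)
    distinct′ : ∀ i j → lookup (tabulate (map elt ∘ t)) i ↭ lookup (tabulate (map elt ∘ t)) j → i ≡ j
    distinct′ i j p = distinct i j (↭⇒sort≡ (map⁻-injective elt-injective
      (subst₂ _↭_ (lookup∘tabulate _ i) (lookup∘tabulate _ j) p)))
    complete : ∀ l → IsPartition D (elt x) l → ∃ λ i → l ↭ lookup (tabulate (map elt ∘ t)) i
    complete l part with partition⇒canonical nonneg part
    ... | L , refl , sum₁≡ , sum₂≡ with covers⇒↭ covers L sum₁≡ sum₂≡
    ... | i , L↭ = i , subst (map elt L ↭_) (sym (lookup∘tabulate _ i)) (↭P.map⁺ elt L↭)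

  elt₂₊-totPos : ∀ k → TotPos D (elt (suc k , 2))
  elt₂₊-totPos k = elt₂-totPos (suc k) (ℕP.<-≤-trans upper (square-mono-≤ (ℕP.+-monoˡ-≤ c (s≤s (s≤s z≤n)))))

  four-partitions : ∃ λ α → InOKPlus D α × PartitionCount D α 4
  four-partitions = elt (2 , 1) , (fromCoords-inOK (canonical (2 , 1)) , elt₁-totPos 2) ,
    partitionCount (2 , 1) partitions-2+ω nonneg isPartition
      (toWitness {a? = distinct? partitions-2+ω} _) (toWitness {a? = covers? (2 , 1) partitions-2+ω} _)
    where
    nonneg : NonnegSummands (canonical (2 , 1))
    nonneg with Dh² ℕ.<? (1 ℕ.+ c) ℕ.* (1 ℕ.+ c)
    ... | yes ω′>½ = nonnegSummands-ω′>½ ω′>½ refl (+≤+ z≤n)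
    ... | no ω′≯½ = nonnegSummands-ω′<½ ω′≯½ refl (+≤+ z≤n)
    entry : ∀ i → partitions-2+ω i ≢ [] → All (TotPos D ∘ elt) (partitions-2+ω i) →
            sumE (map canonical (partitions-2+ω i)) ≡ canonical (2 , 1) →
            IsPartition D (elt (2 , 1)) (map elt (partitions-2+ω i))
    entry i = canonical-isPartition (2 , 1) (partitions-2+ω i)
    isPartition : ∀ i → IsPartition D (elt (2 , 1)) (map elt (partitions-2+ω i))
    isPartition i@zero = entry i (λ ()) (elt₁-totPos 2 ∷ []) refl
    isPartition i@(suc zero) = entry i (λ ()) (elt₁-totPos 1 ∷ elt₀-totPos 0 ∷ []) refl
    isPartition i@(suc (suc zero)) = entry i (λ ()) (elt₁-totPos 0 ∷ elt₀-totPos 1 ∷ []) refl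
    isPartition i@(suc (suc (suc zero))) = entry i (λ ()) (elt₁-totPos 0 ∷ elt₀-totPos 0 ∷ elt₀-totPos 0 ∷ []) refl

  six-partitions : ω′>½ B → ∃ λ α → InOKPlus D α × PartitionCount D α 6
  six-partitions ω′>½ = elt (2 , 2) , (fromCoords-inOK (canonical (2 , 2)) , elt₂₊-totPos 1) ,
    partitionCount (2 , 2) partitions-1+2ω (nonnegSummands-ω′>½ ω′>½ refl (+≤+ z≤n)) isPartition
      (toWitness {a? = distinct? partitions-1+2ω} _) (toWitness {a? = covers? (2 , 2) partitions-1+2ω} _)
    where
    2ω-1 : TotPos D (elt (0 , 2))
    2ω-1 = elt₂-totPos 0 ω′>½
    entry : ∀ i → partitions-1+2ω i ≢ [] → All (TotPos D ∘ elt) (partitions-1+2ω i) →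
            sumE (map canonical (partitions-1+2ω i)) ≡ canonical (2 , 2) →
            IsPartition D (elt (2 , 2)) (map elt (partitions-1+2ω i))
    entry i = canonical-isPartition (2 , 2) (partitions-1+2ω i)
    isPartition : ∀ i → IsPartition D (elt (2 , 2)) (map elt (partitions-1+2ω i))
    isPartition i@zero = entry i (λ ()) (elt₂₊-totPos 1 ∷ []) refl
    isPartition i@(suc zero) = entry i (λ ()) (2ω-1 ∷ elt₀-totPos 1 ∷ []) refl
    isPartition i@(suc (suc zero)) = entry i (λ ()) (2ω-1 ∷ elt₀-totPos 0 ∷ elt₀-totPos 0 ∷ []) refl
    isPartition i@(suc (suc (suc zero))) = entry i (λ ()) (elt₂₊-totPos 0 ∷ elt₀-totPos 0 ∷ []) refl
    isPartition i@(suc (suc (suc (suc zero)))) = entry i (λ ()) (elt₁-totPos 0 ∷ elt₁-totPos 1 ∷ []) refl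
    isPartition i@(suc (suc (suc (suc (suc zero))))) =
      entry i (λ ()) (elt₁-totPos 0 ∷ elt₁-totPos 0 ∷ elt₀-totPos 0 ∷ []) refl

-- Constructing a basis

2∣2* : ∀ w → + 2 ∣ + 2 * w
2∣2* w = ∣⇒∣ᵤ (divides w (ℤP.*-comm (+ 2) w))

2∣⇒double : ∀ {z} → + 2 ∣ z → ∃ λ t → + 2 * t ≡ z
2∣⇒double {z} 2∣z with ∣ᵤ⇒∣ 2∣z
... | divides t z≡t*2 = t , trans (ℤP.*-comm (+ 2) t) (sym z≡t*2)

-- D ≡ 1 (mod 4): ω = ((2r + 3) + √D)/2 = (r + 1) + (1 + √D)/2.
basis-odd : ∀ {D} r → D % 4 ≡ 1 → suc (r ℕ.+ r) ℕ.* suc (r ℕ.+ r) ℕ.< D →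
            D ℕ.< (3 ℕ.+ (r ℕ.+ r)) ℕ.* (3 ℕ.+ (r ℕ.+ r)) → Basis D
basis-odd {D} r D≡1 lower upper = record
  { c = suc (r ℕ.+ r) ; h = 1
  ; lower = subst (_ ℕ.<_) (sym (ℕP.*-identityʳ D)) lower
  ; upper = subst (ℕ._< _) (sym (ℕP.*-identityʳ D)) upper
  ; c≥1 = s≤s z≤n
  ; ω′>½⇒c≥2 = c≥2 r lower D≡1 ∘ subst (ℕ._< _) (ℕP.*-identityʳ D)
  ; fromCoords-inOK = inOK
  ; fromCoords-onto = onto
  }
  where
  c≥2 : ∀ {D} r → suc (r ℕ.+ r) ℕ.* suc (r ℕ.+ r) ℕ.< D → D % 4 ≡ 1 →
        D ℕ.< (2 ℕ.+ (r ℕ.+ r)) ℕ.* (2 ℕ.+ (r ℕ.+ r)) → 2 ≤ suc (r ℕ.+ r)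
  c≥2 (suc r) _ _ _ = s≤s (s≤s z≤n)
  c≥2 {1} zero (s≤s ()) _ _
  c≥2 {2} zero _ () _
  c≥2 {3} zero _ () _
  c≥2 {suc (suc (suc (suc _)))} zero _ _ (s≤s (s≤s (s≤s (s≤s ()))))
  inOK : ∀ p → InOK D (fromCoords (suc (r ℕ.+ r)) 1 p)
  inOK (u , v) = inj₁ (D≡1 , subst (+ 2 ∣_) (sym (regroup u v (+ r))) (2∣2* (u + (+ 1 + + r) * v)))
    where
    regroup : ∀ u v R → + 2 * u + (+ 2 + (+ 1 + (R + R))) * v - + 1 * v ≡ + 2 * (u + (+ 1 + R) * v)
    regroup = solve-∀
  onto : ∀ q → InOK D q → ∃ λ p → fromCoords (suc (r ℕ.+ r)) 1 p ≡ q
  onto (x , y) (inj₂ (D≢1 , _)) = ⊥-elim (D≢1 D≡1)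
  onto (x , y) (inj₁ (_ , 2∣x-y)) with 2∣⇒double {x - y} 2∣x-y
  ... | t , 2t≡x-y = (t - (+ 1 + + r) * y , y) , cong₂ _,_ first (ℤP.*-identityˡ y)
    where
    regroup : ∀ t y R → + 2 * (t - (+ 1 + R) * y) + (+ 2 + (+ 1 + (R + R))) * y ≡ + 2 * t + y
    regroup = solve-∀
    first : + 2 * (t - (+ 1 + + r) * y) + + (3 ℕ.+ (r ℕ.+ r)) * y ≡ x
    first = trans (regroup t y (+ r)) (trans (cong (_+ y) 2t≡x-y) (sub-add x y))

-- D ≢ 1 (mod 4): ω = ((2a + 2) + 2√D)/2 = (a + 1) + √D.
basis-even : ∀ {D} a → D % 4 ≢ 1 → 1 ≤ a → a ℕ.* a ℕ.< D → D ℕ.< suc a ℕ.* suc a → Basis D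
basis-even {D} a D≢1 a≥1 lower upper = record
  { c = a ℕ.+ a ; h = 2
  ; lower = subst₂ ℕ._<_ (quadruple a) (ℕP.*-comm 4 D) (ℕP.*-monoʳ-< 4 lower)
  ; upper = subst₂ ℕ._<_ (ℕP.*-comm 4 D) (quadruple′ a) (ℕP.*-monoʳ-< 4 upper)
  ; c≥1 = ℕP.≤-trans a≥1 (ℕP.m≤m+n a a)
  ; ω′>½⇒c≥2 = λ _ → ℕP.+-mono-≤ a≥1 a≥1
  ; fromCoords-inOK = inOK
  ; fromCoords-onto = onto
  }
  where
  quadruple : ∀ a → 4 ℕ.* (a ℕ.* a) ≡ (a ℕ.+ a) ℕ.* (a ℕ.+ a)
  quadruple = ℕ-solve
  quadruple′ : ∀ a → 4 ℕ.* (suc a ℕ.* suc a) ≡ (2 ℕ.+ (a ℕ.+ a)) ℕ.* (2 ℕ.+ (a ℕ.+ a))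
  quadruple′ = ℕ-solve
  inOK : ∀ p → InOK D (fromCoords (a ℕ.+ a) 2 p)
  inOK (u , v) =
    inj₂ (D≢1 , subst (+ 2 ∣_) (sym (regroup u v (+ a))) (2∣2* (u + (+ 1 + + a) * v)) , 2∣2* v)
    where
    regroup : ∀ u v A → + 2 * u + (+ 2 + (A + A)) * v ≡ + 2 * (u + (+ 1 + A) * v)
    regroup = solve-∀
  onto : ∀ q → InOK D q → ∃ λ p → fromCoords (a ℕ.+ a) 2 p ≡ q
  onto (x , y) (inj₁ (D≡1 , _)) = ⊥-elim (D≢1 D≡1)
  onto (x , y) (inj₂ (_ , 2∣x , 2∣y)) with 2∣⇒double {x} 2∣x | 2∣⇒double {y} 2∣y
  ... | s , 2s≡x | t , 2t≡y = (s - (+ 1 + + a) * t , t) , cong₂ _,_ (trans (regroup s t (+ a)) 2s≡x) 2t≡y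
    where
    regroup : ∀ s t A → + 2 * (s - (+ 1 + A) * t) + (+ 2 + (A + A)) * t ≡ + 2 * s
    regroup = solve-∀

floor-sqrt : ∀ D → ∃ λ a → a ℕ.* a ≤ D × D ℕ.< suc a ℕ.* suc a
floor-sqrt zero = 0 , z≤n , s≤s z≤n
floor-sqrt (suc D) with floor-sqrt D
... | a , a²≤D , D<[1+a]² with suc D ℕ.<? suc a ℕ.* suc a
...   | yes 1+D<[1+a]² = a , ℕP.m≤n⇒m≤1+n a²≤D , 1+D<[1+a]²
...   | no 1+D≮[1+a]² = suc a , ℕP.≮⇒≥ 1+D≮[1+a]² ,
          ℕP.≤-<-trans D<[1+a]² (ℕP.*-mono-< (ℕP.n<1+n (suc a)) (ℕP.n<1+n (suc a)))

even-or-odd : ∀ a → ∃ λ r → a ≡ r ℕ.+ r ⊎ a ≡ suc (r ℕ.+ r)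
even-or-odd zero = 0 , inj₁ refl
even-or-odd (suc a) with even-or-odd a
... | r , inj₁ a≡2r = r , inj₂ (cong suc a≡2r)
... | r , inj₂ a≡1+2r = suc r , inj₁ (cong suc (trans a≡1+2r (sym (ℕP.+-suc r r))))

squareFree⇒nonSquare : ∀ {D} → 2 ≤ D → SquareFree D → ∀ a → a ℕ.* a ≢ D
squareFree⇒nonSquare 2≤D squareFree a a²≡D with squareFree a (subst (a ℕ.* a ℕD.∣_) a²≡D ℕD.∣-refl)
... | refl = ℕP.<⇒≢ 2≤D a²≡D

-- c is the largest integer below h√D of the parity that makes ω integral.
floor-basis : ∀ {D} a → 2 ≤ D → a ℕ.* a ℕ.< D → D ℕ.< suc a ℕ.* suc a → Basis D
floor-basis {D} a 2≤D a²<D D<[1+a]² with D % 4 ℕ.≟ 1 | even-or-odd a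
... | no D≢1 | _ = basis-even a D≢1 (a≥1 a D<[1+a]²) a²<D D<[1+a]²
  where
  a≥1 : ∀ a → D ℕ.< suc a ℕ.* suc a → 1 ≤ a
  a≥1 zero (s≤s D≤0) = ⊥-elim (ℕP.<⇒≱ 2≤D (ℕP.≤-trans D≤0 z≤n))
  a≥1 (suc _) _ = s≤s z≤n
... | yes D≡1 | r , inj₂ refl =
  basis-odd r D≡1 a²<D (ℕP.<-≤-trans D<[1+a]² (square-mono-≤ (ℕP.n≤1+n (2 ℕ.+ (r ℕ.+ r)))))
... | yes D≡1 | zero , inj₁ refl = ⊥-elim (ℕP.<⇒≱ 2≤D (ℕP.≤-trans (ℕP.<⇒≤ D<[1+a]²) (s≤s z≤n)))
... | yes D≡1 | suc r , inj₁ refl = basis-odd r D≡1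
  (ℕP.≤-<-trans (square-mono-≤ (s≤s (ℕP.+-monoʳ-≤ r (ℕP.n≤1+n r)))) a²<D)
  (subst (λ t → D ℕ.< t ℕ.* t) (cong (2 ℕ.+_) (ℕP.+-suc r r)) D<[1+a]²)

basis : ∀ {D} → 2 ≤ D → SquareFree D → Basis D
basis {D} 2≤D squareFree with floor-sqrt D
... | a , a²≤D , D<[1+a]² =
  floor-basis a 2≤D (ℕP.≤∧≢⇒< a²≤D (squareFree⇒nonSquare 2≤D squareFree a)) D<[1+a]²

-- For ξ = (x + y√D)/2 with y > 0, n < ξ < n + 1/2 means 2n − x < y√D < 2n + 1 − x;
-- the lower bound is ≥ 0 because the two bounds differ by 1.
ceilGap-squeeze : ∀ {D x y} n → 0ℤ ℤ.< y →
  PosSqrt D (x - + 2 * n) y → PosSqrt D (+ 2 * n + + 1 - x) (- y) →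
  0ℤ ℤ.< + 2 * n + + 1 - x ×
  (x - + 2 * n) * (x - + 2 * n) ℤ.< + D * (y * y) ×
  + D * (y * y) ℤ.< (+ 2 * n + + 1 - x) * (+ 2 * n + + 1 - x)
ceilGap-squeeze n 0<y _ (inj₂ (0<-y , _)) =
  ⊥-elim (ℤP.<-asym 0<y (subst (ℤ._< 0ℤ) (ℤP.neg-involutive _) (ℤP.neg-mono-< 0<-y)))
ceilGap-squeeze {x = x} n _ (inj₁ (0<A , _)) (inj₁ (0<B , _)) = ⊥-elim (pos+pos≢1 0<A 0<B (sums-to-1 x n))
  where
  sums-to-1 : ∀ x n → (x - + 2 * n) + (+ 2 * n + + 1 - x) ≡ + 1
  sums-to-1 = solve-∀
ceilGap-squeeze {D} {y = y} n _ (inj₂ (_ , A²<Dy²)) (inj₁ (0<B , Dy²<B²)) =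
  0<B , A²<Dy² , subst (λ t → + D * t ℤ.< _) (neg-square y) Dy²<B²

xi-odd : ∀ {D} → D % 4 ≡ 1 → xi D ≡ (- + 1 , + 1)
xi-odd D≡1 rewrite D≡1 = refl

xi-even : ∀ {D} → D % 4 ≢ 1 → xi D ≡ (0ℤ , + 2)
xi-even {D} D≢1 with D % 4
... | 0 = refl
... | 1 = ⊥-elim (D≢1 refl)
... | suc (suc _) = refl

ceilGap-odd : ∀ {D} → D % 4 ≡ 1 → ∀ n → PosSqrt D (- + 1 - + 2 * n) (+ 1) →
  PosSqrt D (+ 2 * n + + 1 - - + 1) (- + 1) → Σ (Basis D) ω′>½
ceilGap-odd {D} D≡1 n ξ-n>0 n+½-ξ>0
  with ceilGap-squeeze {D} { - + 1} {+ 1} n (+<+ (s≤s z≤n)) ξ-n>0 n+½-ξ>0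
ceilGap-odd {D} D≡1 -[1+ k ] _ _ | 0<2n+2 , _ =
  ⊥-elim (0≮- (k ℕ.+ k) (subst (0ℤ ℤ.<_) (rearrange (+ k)) 0<2n+2))
  where
  rearrange : ∀ K → + 2 * - (+ 1 + K) + + 1 - - + 1 ≡ - (K + K)
  rearrange = solve-∀
ceilGap-odd {D} D≡1 (+ r) _ _ | _ , [2r+1]²<D , D<[2r+2]² =
  basis-odd r D≡1 lower (ℕP.<-≤-trans upper (square-mono-≤ (ℕP.n≤1+n (2 ℕ.+ (r ℕ.+ r))))) ,
  subst (ℕ._< _) (sym (ℕP.*-identityʳ D)) upper
  where
  odd-square : ∀ R → (- + 1 - + 2 * R) * (- + 1 - + 2 * R) ≡ (+ 1 + (R + R)) * (+ 1 + (R + R))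
  odd-square = solve-∀
  even-root : ∀ R → + 2 * R + + 1 - - + 1 ≡ + 2 + (R + R)
  even-root = solve-∀
  lower : suc (r ℕ.+ r) ℕ.* suc (r ℕ.+ r) ℕ.< D
  lower = ℤP.drop‿+<+ (subst₂ ℤ._<_ (trans (odd-square (+ r)) (square-pos (suc (r ℕ.+ r))))
    (ℤP.*-identityʳ (+ D)) [2r+1]²<D)
  upper : D ℕ.< (2 ℕ.+ (r ℕ.+ r)) ℕ.* (2 ℕ.+ (r ℕ.+ r))
  upper = ℤP.drop‿+<+ (subst₂ ℤ._<_ (ℤP.*-identityʳ (+ D))
    (trans (cong (λ t → t * t) (even-root (+ r))) (square-pos (2 ℕ.+ (r ℕ.+ r)))) D<[2r+2]²)

ceilGap-even : ∀ {D} → D % 4 ≢ 1 → 2 ≤ D → ∀ n → PosSqrt D (0ℤ - + 2 * n) (+ 2) →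
  PosSqrt D (+ 2 * n + + 1 - 0ℤ) (- + 2) → Σ (Basis D) ω′>½
ceilGap-even {D} D≢1 2≤D n ξ-n>0 n+½-ξ>0
  with ceilGap-squeeze {D} {0ℤ} {+ 2} n (+<+ (s≤s z≤n)) ξ-n>0 n+½-ξ>0
ceilGap-even {D} D≢1 2≤D -[1+ k ] _ _ | 0<2n+1 , _ =
  ⊥-elim (0≮- (suc (k ℕ.+ k)) (subst (0ℤ ℤ.<_) (rearrange (+ k)) 0<2n+1))
  where
  rearrange : ∀ K → + 2 * - (+ 1 + K) + + 1 - 0ℤ ≡ - (+ 1 + (K + K))
  rearrange = solve-∀
ceilGap-even {D} D≢1 2≤D (+ a) _ _ | _ , [2a]²<4D , 4D<[2a+1]² =
  basis-even a D≢1 (a≥1 a 4D<[1+2a]²) lower upper , 4D<[1+2a]²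
  where
  even-square : ∀ A → (0ℤ - + 2 * A) * (0ℤ - + 2 * A) ≡ (A + A) * (A + A)
  even-square = solve-∀
  odd-root : ∀ A → + 2 * A + + 1 - 0ℤ ≡ + 1 + (A + A)
  odd-root = solve-∀
  quadruple : ∀ a → (a ℕ.+ a) ℕ.* (a ℕ.+ a) ≡ 4 ℕ.* (a ℕ.* a)
  quadruple = ℕ-solve
  quadruple′ : ∀ a → (2 ℕ.+ (a ℕ.+ a)) ℕ.* (2 ℕ.+ (a ℕ.+ a)) ≡ 4 ℕ.* (suc a ℕ.* suc a)
  quadruple′ = ℕ-solve
  [2a]²<D*4 : (a ℕ.+ a) ℕ.* (a ℕ.+ a) ℕ.< D ℕ.* (2 ℕ.* 2)
  [2a]²<D*4 = ℤP.drop‿+<+ (subst₂ ℤ._<_ (trans (even-square (+ a)) (square-pos (a ℕ.+ a)))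
    (sym (ℤP.pos-* D 4)) [2a]²<4D)
  4D<[1+2a]² : D ℕ.* (2 ℕ.* 2) ℕ.< (1 ℕ.+ (a ℕ.+ a)) ℕ.* (1 ℕ.+ (a ℕ.+ a))
  4D<[1+2a]² = ℤP.drop‿+<+ (subst₂ ℤ._<_ (sym (ℤP.pos-* D 4))
    (trans (cong (λ t → t * t) (odd-root (+ a))) (square-pos (1 ℕ.+ (a ℕ.+ a)))) 4D<[2a+1]²)
  lower : a ℕ.* a ℕ.< D
  lower = ℕP.*-cancelˡ-< 4 _ _ (subst₂ ℕ._<_ (quadruple a) (ℕP.*-comm D 4) [2a]²<D*4)
  upper : D ℕ.< suc a ℕ.* suc a
  upper = ℕP.*-cancelˡ-< 4 _ _ (subst₂ ℕ._<_ (ℕP.*-comm D 4) (quadruple′ a)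
    (ℕP.<-≤-trans 4D<[1+2a]² (square-mono-≤ (ℕP.n≤1+n (suc (a ℕ.+ a))))))
  a≥1 : ∀ a → D ℕ.* (2 ℕ.* 2) ℕ.< (1 ℕ.+ (a ℕ.+ a)) ℕ.* (1 ℕ.+ (a ℕ.+ a)) → 1 ≤ a
  a≥1 (suc _) _ = s≤s z≤n
  a≥1 zero 4D<1 = ⊥-elim (ℕP.<⇒≱ 4D<1 (ℕP.≤-trans (ℕP.<⇒≤ 2≤D) (ℕP.m≤m*n D 4)))

ceilGap⇒basis : ∀ {D} → 2 ≤ D → CeilGap D → Σ (Basis D) ω′>½
ceilGap⇒basis {D} 2≤D (n , ξ-n>0 , n+½-ξ>0) with D % 4 ℕ.≟ 1
... | yes D≡1 = ceilGap-odd D≡1 n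
  (subst (λ ξ → PosSqrt D (proj₁ ξ - + 2 * n) (proj₂ ξ)) (xi-odd {D} D≡1) ξ-n>0)
  (subst (λ ξ → PosSqrt D (+ 2 * n + + 1 - proj₁ ξ) (- proj₂ ξ)) (xi-odd {D} D≡1) n+½-ξ>0)
... | no D≢1 = ceilGap-even D≢1 2≤D n
  (subst (λ ξ → PosSqrt D (proj₁ ξ - + 2 * n) (proj₂ ξ)) (xi-even {D} D≢1) ξ-n>0)
  (subst (λ ξ → PosSqrt D (+ 2 * n + + 1 - proj₁ ξ) (- proj₂ ξ)) (xi-even {D} D≢1) n+½-ξ>0)

theorem1p4 : ∀ (D : ℕ) → 2 ≤ D → SquareFree D →
    (∃ λ α → InOKPlus D α × PartitionCount D α 4) ×
    (CeilGap D → ∃ λ α → InOKPlus D α × PartitionCount D α 6)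
theorem1p4 D 2≤D squareFree =
  WithBasis.four-partitions (basis 2≤D squareFree) ,
  uncurry WithBasis.six-partitions ∘ ceilGap⇒basis 2≤D
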